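{- In the setting below, let $v$ be a node of $G$ and $X$ a set of nodes with $v\circ\!\!\to X$ or $X\to\!\bullet\, v$. Then $v\,\bar{\mathcal{C}}\,v$ if and only if $w\,\bar{\mathcal{C}}\,w$ for all $w\in X$.
   Context: Petri nets. A Petri net is $N=(P,T,\mathbf{pre},\mathbf{post})$ with finite disjoint sets of places $P$ and transitions $T$ and $\mathbf{pre},\mathbf{post}:T\to(P\to\mathbb{N})$. A marking is $m:P\to\mathbb{N}$. Transition $t$ is enabled at $m$ if $m(p)\ge\mathbf{pre}(t,p)$ for all $p$; firing it yields $m'=m-\mathbf{pre}(t)+\mathbf{post}(t)$. $R(N,m_0)$ is the set of markings reachable from $m_0$. $(N,m_0)$ is safe if every reachable marking has $m(p)\le1$ for all $p$. Equations. Solutions of a linear system $E$ (variables $\mathrm{fv}(E)$) are total non-negative integer assignments satisfying all equations; $E$ is consistent if it has one. Fix pairwise disjoint sets $K(n)$, $n\in\mathbb{N}$, of constant symbols, $K=\bigcup_n K(n)$; a constant in $K(n)$ stands for $n$. Every equation of $E$ has the form $v=\sum_{x\in X}x$ with $X$ a nonempty finite set of variables and $v$ a variable or constant. For a partial map $m$ defined exactly on $x_1,\dots,x_k$, $\llbracket m\rrbracket$ is the system $x_1=m(x_1),\dots,x_k=m(x_k)$; commas denote union of systems. $E$-equivalence: $(N_1,m_1)\vartriangleright_E(N_2,m_2)$ iff (A1) $E,\llbracket m\rrbracket$ is consistent for every $m\in R(N_1,m_1)\cup R(N_2,m_2)$; (A2) $E,\llbracket m_1\rrbracket,\llbracket m_2\rrbracket$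 is consistent; (A3) for all markings $m_1'$ of $N_1$, $m_2'$ of $N_2$ with $E,\llbracket m_1'\rrbracket,\llbracket m_2'\rrbracket$ consistent, $m_1'\in R(N_1,m_1)$ iff $m_2'\in R(N_2,m_2)$. Token Flow Graphs. A TFG is $(V,R,A)$ with $V=P\cup S$, $S\subset K$ finite, disjoint $R,A\subseteq V\times V$. Write $v\to\!\bullet\, w$ for $(v,w)\in R$, $v\circ\!\!\to w$ for $(v,w)\in A$, $v\to w$ for either, $\to^\star$ for the reflexive-transitive closure. A root is a node that is the target of no arc. $v\circ\!\!\to X$ means $X$ is the nonempty set of all $w$ with $v\circ\!\!\to w$; $X\to\!\bullet\, v$ means $X$ is the nonempty set of all $w$ with $w\to\!\bullet\, v$. Well-formed for $(N_1,m_1)\vartriangleright_E(N_2,m_2)$ (place sets $P_1,P_2$): (T1) $V\setminus K=P_1\cup P_2\cup\mathrm{fv}(E)$; (T2) nodes in $V\cap K$ are roots; (T3) one cannot have $p\circ\!\!\to q$ and $p'\to q$ with $p\ne p'$, nor both $p\to\!\bullet\, q$ and $p\circ\!\!\to q$; (T4) $v\circ\!\!\to X$ or $X\to\!\bullet\, v$ iff the equation $v=\sum_{x\in X}x$ is in $E$. Configurations. A configuration is a partial $c:V\to\mathbb{N}$ with $c(v)=n$ for $v\in V\cap K(n)$; total if defined everywhere; $c_{\mid N}$ is its restriction to places of $N$. Well-defined: (CBot) if $v\to w$, $c(v)$ undefined iff $c(w)$ undefined; (CEq) if $c(v)$ defined and ($v\circ\!\!\to X$ or $X\to\!\bullet\,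 v$), $c(v)=\sum_{x\in X}c(x)$. Setting: $(N_1,m_1)\vartriangleright_E(N_2,m_2)$ with both nets safe; $G$ is a well-formed TFG for it; every constant node lies in $K(0)\cup K(1)$; every root is a constant or a place of $N_2$; every node has a path to a place of $N_1$. The concurrency relation $\mathcal{C}$ of $G$: $v\,\mathcal{C}\,w$ iff there is a total, well-defined configuration $c$ with $c_{\mid N_2}\in R(N_2,m_2)$, $c(v)>0$ and $c(w)>0$. $v\,\bar{\mathcal{C}}\,w$ means not $v\,\mathcal{C}\,w$ (so $v\,\bar{\mathcal{C}}\,v$ means $v$ is dead). -}

module Defs where

open import Data.Nat using (ℕ; zero; suc; _+_; _∸_; _≤_)
open import Data.Fin using (Fin)
open import Data.List using (List; []; _∷_; map)
open import Data.List.Membership.Propositional using (_∈_)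
open import Data.List.Relation.Unary.All using (All)
open import Data.List.Relation.Unary.Unique.Propositional using (Unique)
open import Data.Nat.ListAction using (sum)
open import Data.Maybe using (Maybe; just; nothing)
open import Data.Product using (Σ; ∃; ∃-syntax; _×_; _,_)
open import Data.Sum using (_⊎_)
open import Data.Empty using (⊥)
open import Relation.Nullary using (¬_)
open import Relation.Binary.PropositionalEquality using (_≡_; _≢_)
open import Relation.Binary.Construct.Closure.ReflexiveTransitive using (Star)
open import Function.Bundles using (_⇔_)
open import Function.Definitions using (Injective)

-- Variables (place names and free variables of E) are natural numbers.
-- Constant symbols: cst n i is the i-th symbol of K(n); so the K(n) are
-- pairwise disjoint and cst n i stands for the value n.

Var : Set
Var = ℕ

data Node : Set where
  var : Var → Node
  cst : ℕ → ℕ → Node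

record Net : Set where
  field
    nP nT     : ℕ
    place     : Fin nP → Var
    place-inj : Injective _≡_ _≡_ place
    pre post  : Fin nT → Fin nP → ℕ
open Net public

Marking : Net → Set
Marking N = Fin (nP N) → ℕ

Enabled : (N : Net) → Fin (nT N) → Marking N → Set
Enabled N t m = ∀ p → pre N t p ≤ m p

-- for an enabled transition this is m - pre(t) + post(t)
fire : (N : Net) → Fin (nT N) → Marking N → Marking N
fire N t m p = m p ∸ pre N t p + post N t p

data Reach (N : Net) (m₀ : Marking N) : Marking N → Set where
  base : ∀ {m} → (∀ p → m p ≡ m₀ p) → Reach N m₀ m
  step : ∀ {m m'} (t : Fin (nT N)) → Reach N m₀ m → Enabled N t m →
         (∀ p → m' p ≡ fire N t m p) → Reach N m₀ m'

Safe : (N : Net) → Marking N → Set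
Safe N m₀ = ∀ m → Reach N m₀ m → ∀ p → m p ≤ 1

-- Linear equations  v = Σ_{x ∈ X} x  (v a variable or a constant,
-- X a nonempty finite set of variables, given as a duplicate-free list).

record Eqn : Set where
  field
    lhs          : Node
    rhs          : List Var
    rhs-nonempty : rhs ≢ []
    rhs-unique   : Unique rhs
open Eqn public

nodeVal : (Var → ℕ) → Node → ℕ
nodeVal σ (var x)   = σ x
nodeVal σ (cst n i) = n

SatEqn : (Var → ℕ) → Eqn → Set
SatEqn σ e = nodeVal σ (lhs e) ≡ sum (map σ (rhs e))

Sat : List Eqn → (Var → ℕ) → Set
Sat E σ = All (SatEqn σ) E

_∈fv_ : Var → List Eqn → Set
x ∈fv E = ∃[ e ] (e ∈ E × (lhs e ≡ var x ⊎ x ∈ rhs e))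

Agrees : (N : Net) → (Var → ℕ) → Marking N → Set
Agrees N σ m = ∀ p → σ (place N p) ≡ m p

Consistent : List Eqn → (N : Net) → Marking N → Set
Consistent E N m = ∃[ σ ] (Sat E σ × Agrees N σ m)

Consistent₂ : List Eqn → (N₁ : Net) → Marking N₁ → (N₂ : Net) → Marking N₂ → Set
Consistent₂ E N₁ m₁ N₂ m₂ = ∃[ σ ] (Sat E σ × Agrees N₁ σ m₁ × Agrees N₂ σ m₂)

record EEquiv (N₁ : Net) (m₁ : Marking N₁) (E : List Eqn)
              (N₂ : Net) (m₂ : Marking N₂) : Set where
  field
    A1₁ : ∀ m → Reach N₁ m₁ m → Consistent E N₁ m
    A1₂ : ∀ m → Reach N₂ m₂ m → Consistent E N₂ m
    A2  : Consistent₂ E N₁ m₁ N₂ m₂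
    A3  : ∀ (m₁' : Marking N₁) (m₂' : Marking N₂) →
          Consistent₂ E N₁ m₁' N₂ m₂' → (Reach N₁ m₁ m₁' ⇔ Reach N₂ m₂ m₂')

record TFG : Set where
  field
    vars   : List Var
    consts : List (ℕ × ℕ)      -- S ⊂ K  ((n , i) ↦ cst n i)
    R A    : List (Node × Node)
open TFG public

InV : TFG → Node → Set
InV G (var x)   = x ∈ vars G
InV G (cst n i) = (n , i) ∈ consts G

RArc : TFG → Node → Node → Set
RArc G v w = (v , w) ∈ R G

AArc : TFG → Node → Node → Set
AArc G v w = (v , w) ∈ A G

Arc : TFG → Node → Node → Set
Arc G v w = RArc G v w ⊎ AArc G v w

record IsTFG (G : TFG) : Set where
  field
    R⊆V×V  : ∀ v w → RArc G v w → InV G v × InV G w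
    A⊆V×V  : ∀ v w → AArc G v w → InV G v × InV G w
    R∩A≡∅  : ∀ v w → RArc G v w → AArc G v w → ⊥

Root : TFG → Node → Set
Root G v = ∀ u → ¬ Arc G u v

OutA : TFG → Node → (Node → Set) → Set
OutA G v X = (∀ w → (X w ⇔ AArc G v w)) × ∃ X

InR : TFG → (Node → Set) → Node → Set
InR G X v = (∀ w → (X w ⇔ RArc G w v)) × ∃ X

EqnIs : Eqn → Node → (Node → Set) → Set
EqnIs e v X = lhs e ≡ v × (∀ w → (X w ⇔ w ∈ map var (rhs e)))

record WellFormed (G : TFG) (N₁ N₂ : Net) (E : List Eqn) : Set₁ where
  field
    T1  : ∀ x → (x ∈ vars G ⇔
                 ((∃[ p ] place N₁ p ≡ x) ⊎ (∃[ p ] place N₂ p ≡ x) ⊎ x ∈fv E))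
    T2  : ∀ n i → (n , i) ∈ consts G → Root G (cst n i)
    T3a : ∀ p p' q → AArc G p q → Arc G p' q → p ≢ p' → ⊥
    T3b : ∀ p q → RArc G p q → AArc G p q → ⊥
    T4  : ∀ v (X : Node → Set) →
          ((OutA G v X ⊎ InR G X v) ⇔ (∃[ e ] (e ∈ E × EqnIs e v X)))

-- Configurations (partial maps, nothing = undefined).

record Config (G : TFG) (c : Node → Maybe ℕ) : Set where
  field
    outside  : ∀ v → ¬ InV G v → c v ≡ nothing
    constVal : ∀ n i → (n , i) ∈ consts G → c (cst n i) ≡ just n

Total : TFG → (Node → Maybe ℕ) → Set
Total G c = ∀ v → InV G v → ∃[ k ] c v ≡ just k

msum : (Node → Maybe ℕ) → List Node → Maybe ℕ
msum c []       = just 0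
msum c (x ∷ xs) with c x | msum c xs
... | just a  | just b = just (a + b)
... | _       | _      = nothing

record WellDefined (G : TFG) (c : Node → Maybe ℕ) : Set₁ where
  field
    CBot : ∀ v w → Arc G v w → (c v ≡ nothing ⇔ c w ≡ nothing)
    -- Σ_{x ∈ X} c(x), computed along any duplicate-free enumeration of X
    CEq  : ∀ v k (X : Node → Set) → c v ≡ just k → (OutA G v X ⊎ InR G X v) →
           ∀ (xs : List Node) → Unique xs → (∀ w → (w ∈ xs ⇔ X w)) →
           msum c xs ≡ just k

RestrReach : (Node → Maybe ℕ) → (N : Net) → Marking N → Set
RestrReach c N m₀ = ∃[ m ] ((∀ p → c (var (place N p)) ≡ just (m p)) × Reach N m₀ m)

Pos : (Node → Maybe ℕ) → Node → Set
Pos c v = ∃[ k ] c v ≡ just (suc k)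

Conc : TFG → (N₂ : Net) → Marking N₂ → Node → Node → Set₁
Conc G N₂ m₂ v w =
  ∃[ c ] (Config G c × Total G c × WellDefined G c × RestrReach c N₂ m₂ × Pos c v × Pos c w)

Dead : TFG → (N₂ : Net) → Marking N₂ → Node → Set₁
Dead G N₂ m₂ v = ¬ Conc G N₂ m₂ v v

ConstsIn01 : TFG → Set
ConstsIn01 G = ∀ n i → (n , i) ∈ consts G → n ≤ 1

RootsOK : TFG → Net → Set
RootsOK G N₂ = ∀ v → InV G v → Root G v →
               (∃[ n ] ∃[ i ] v ≡ cst n i) ⊎ (∃[ p ] v ≡ var (place N₂ p))

PathsToN₁ : TFG → Net → Set
PathsToN₁ G N₁ = ∀ v → InV G v → ∃[ p ] Star (Arc G) v (var (place N₁ p))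

{-# OPTIONS --safe #-}
-- Every total, well-defined configuration c satisfies the equation v = Σ_{w ∈ X} w
-- that T4 attaches to the arcs between v and X.  Over ℕ a sum is positive exactly
-- when some summand is, so c(v) > 0 iff c(w) > 0 for some w ∈ X; hence a
-- configuration witnessing v 𝒞 v is one witnessing w 𝒞 w for some w ∈ X, and
-- conversely.
module Submission where

open import Defs
open import Data.List using (List; _∷_; map)
open import Data.List.Membership.Propositional using (_∈_)
open import Data.List.Relation.Unary.Any using (here; there)
open import Data.List.Relation.Unary.Unique.Propositional using (Unique)
open import Data.List.Relation.Unary.Unique.Propositional.Properties using (map⁺)
open import Data.Maybe using (Maybe; just)
open import Data.Maybe.Properties using (just-injective)
open import Data.Nat using (ℕ; zero; suc; _+_)
open import Data.Nat.Properties using (+-suc)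
open import Data.Product using (∃-syntax; _×_; _,_)
open import Data.Sum using (_⊎_)
open import Function.Bundles using (_⇔_; mk⇔; Equivalence)
open import Relation.Binary.PropositionalEquality using (_≡_; refl; sym; trans; cong)

var-injective : ∀ {x y} → var x ≡ var y → x ≡ y
var-injective refl = refl

msum-suc⇒∃Pos : ∀ (c : Node → Maybe ℕ) xs {k} →
                msum c xs ≡ just (suc k) → ∃[ x ] (x ∈ xs × Pos c x)
msum-suc⇒∃Pos c (x ∷ xs) eq with c x in cx | msum c xs in cxs
... | just (suc a) | just b = x , here refl , a , cx
... | just zero    | just b with msum-suc⇒∃Pos c xs (trans cxs (cong just (just-injective eq)))
...   | y , y∈xs , pos = y , there y∈xs , pos

∈∧Pos⇒msum-suc : ∀ (c : Node → Maybe ℕ) xs {x s} →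
                 x ∈ xs → Pos c x → msum c xs ≡ just s → ∃[ k ] s ≡ suc k
∈∧Pos⇒msum-suc c (x ∷ xs) x∈ pos eq with c x in cx | msum c xs in cxs
∈∧Pos⇒msum-suc c (x ∷ xs) (here refl) (a , cx≡) refl | just _ | just b
  with trans (sym cx) cx≡
... | refl = a + b , refl
∈∧Pos⇒msum-suc c (x ∷ xs) (there x∈) pos refl | just a | just b
  with ∈∧Pos⇒msum-suc c xs x∈ pos cxs
... | k , refl = a + k , +-suc a k

Enumeration : (Node → Set) → Set
Enumeration X = ∃[ xs ] (Unique xs × (∀ w → (w ∈ xs ⇔ X w)))

module _ {G : TFG} {N₁ N₂ : Net} {E : List Eqn} (wf : WellFormed G N₁ N₂ E)
         {v : Node} {X : Node → Set} (v⇄X : OutA G v X ⊎ InR G X v) where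

  arcs⇒enumeration : Enumeration X
  arcs⇒enumeration with Equivalence.to (WellFormed.T4 wf v X) v⇄X
  ... | e , _ , _ , X⇔rhs =
    map var (rhs e) , map⁺ var-injective (rhs-unique e) ,
    λ w → mk⇔ (Equivalence.from (X⇔rhs w)) (Equivalence.to (X⇔rhs w))

  Pos⇔∃Pos : ∀ {c} → InV G v → Total G c → WellDefined G c →
             Pos c v ⇔ (∃[ w ] (X w × Pos c w))
  Pos⇔∃Pos {c} v∈G total wd with arcs⇒enumeration
  ... | xs , unique , xs⇔X = mk⇔ to from
    where
    sum-at : ∀ {k} → c v ≡ just k → msum c xs ≡ just k
    sum-at {k} cv = WellDefined.CEq wd v k X cv v⇄X xs unique xs⇔X

    to : Pos c v → ∃[ w ] (X w × Pos c w)
    to (k , cv) with msum-suc⇒∃Pos c xs (sum-at cv)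
    ... | w , w∈xs , pos = w , Equivalence.to (xs⇔X w) w∈xs , pos

    from : ∃[ w ] (X w × Pos c w) → Pos c v
    from (w , Xw , pos) with total v v∈G
    ... | s , cv with ∈∧Pos⇒msum-suc c xs (Equivalence.from (xs⇔X w) Xw) pos (sum-at cv)
    ...   | k , refl = k , cv

module _ {G : TFG} {N₂ : Net} {m₂ : Marking N₂} {v : Node} {X : Node → Set} where

  Dead⇔∀Dead : (∀ {c} → Total G c → WellDefined G c → Pos c v ⇔ (∃[ w ] (X w × Pos c w))) →
               Dead G N₂ m₂ v ⇔ (∀ w → X w → Dead G N₂ m₂ w)
  Dead⇔∀Dead pos⇔ = mk⇔ to from
    where
    to : Dead G N₂ m₂ v → ∀ w → X w → Dead G N₂ m₂ w
    to dead w Xw (c , cfg , total , wd , reach , pos , _) =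
      let posv = Equivalence.from (pos⇔ total wd) (w , Xw , pos)
      in dead (c , cfg , total , wd , reach , posv , posv)

    from : (∀ w → X w → Dead G N₂ m₂ w) → Dead G N₂ m₂ v
    from dead (c , cfg , total , wd , reach , pos , _)
      with Equivalence.to (pos⇔ total wd) pos
    ... | w , Xw , posw = dead w Xw (c , cfg , total , wd , reach , posw , posw)

lemma10 : (N₁ N₂ : Net) (m₁ : Marking N₁) (m₂ : Marking N₂) (E : List Eqn) (G : TFG) →
          EEquiv N₁ m₁ E N₂ m₂ → Safe N₁ m₁ → Safe N₂ m₂ →
          IsTFG G → WellFormed G N₁ N₂ E →
          ConstsIn01 G → RootsOK G N₂ → PathsToN₁ G N₁ →
          (v : Node) (X : Node → Set) → InV G v → (OutA G v X ⊎ InR G X v) →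
          (Dead G N₂ m₂ v ⇔ (∀ w → X w → Dead G N₂ m₂ w))
lemma10 N₁ N₂ m₁ m₂ E G _ _ _ _ wf _ _ _ v X v∈G v⇄X =
  Dead⇔∀Dead (Pos⇔∃Pos wf v⇄X v∈G)
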